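{- Let $L$ be an environment and $T_0,T_1,T_2$ terms. If $L\vdash T_0\to^{*0}T_1$ and $L\vdash T_0\to^{*0}T_2$, then there exists a term $T$ such that $L\vdash T_1\to^{*0}T$ and $L\vdash T_2\to^{*0}T$.
   Context: Fix a nonempty set $\Sigma$ of sorts with decidable equality, an arbitrary function $\mathrm{next}:\Sigma\to\Sigma$, and a countably infinite set of variables. Terms and environments are given by the grammars $T,U,V,W ::= \star s \mid x \mid \mathrm{app}(V,T) \mid \lambda x{:}W.\,T \mid \mathrm{def}(x{=}V).\,T \mid \mathrm{cast}(U,T)$ (with $s\in\Sigma$, $x$ a variable) and $L,K ::= \emptyset \mid K,x{:}W \mid K,x{=}V$. Here $\mathrm{app}(V,T)$ is the application of the function $T$ to the argument $V$; $\lambda x{:}W.\,T$ is de Bruijn's abstraction, binding $x$ in $T$, with expected type $W$; $\mathrm{def}(x{=}V).\,T$ is a local definition (explicit substitution) of $x$ as $V$ in $T$, binding $x$ in $T$; $\mathrm{cast}(U,T)$ annotates $T$ with its expected type $U$. In environments the entry $x{:}W$ declares $x$ with expected type $W$ and $x{=}V$ defines $x$ as $V$; entries bind the free variables of terms considered in that environment. Terms are taken modulo renaming of bound variables, and bound variables are assumed distinct from each other and from free variables. Write $\mathsf{B}x[V]$ for either binder $\lambda x{:}V$ or $\mathrm{def}(x{=}V)$, and correspondingly $L,x[V]$ for $L,x{:}V$ resp. $L,x{=}V$ (same kind in every occurrence within a rule). One step of bound rt-reduction $L\vdash T_1\to^{n}T_2$ is the smallest relation closed under: ($\beta$) $L\vdash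 \mathrm{app}(V,\lambda x{:}W.\,T)\to^0\mathrm{def}(x{=}\mathrm{cast}(W,V)).\,T$; ($\delta$) $K,x{=}V\vdash x\to^0 V$; ($\zeta$) $L\vdash \mathrm{def}(x{=}V).\,T\to^0 T$ if $x$ is not free in $T$; ($\theta$) $L\vdash\mathrm{app}(V,\mathrm{def}(x{=}W).\,T)\to^0\mathrm{def}(x{=}W).\,\mathrm{app}(V,T)$; ($\epsilon$) $L\vdash\mathrm{cast}(U,T)\to^0T$; (s) $L\vdash\star s\to^1\star\,\mathrm{next}(s)$; (l) $K,x{:}W\vdash x\to^1 W$; (e) $L\vdash\mathrm{cast}(U,T)\to^1U$; if $K\vdash x\to^nT$, $y\neq x$ and $y$ is not free in $T$, then $K,y[V]\vdash x\to^nT$; if $L\vdash V_1\to^0V_2$ then $L\vdash\mathrm{app}(V_1,T)\to^0\mathrm{app}(V_2,T)$; if $L\vdash T_1\to^nT_2$ then $L\vdash\mathrm{app}(V,T_1)\to^n\mathrm{app}(V,T_2)$; if $L\vdash V_1\to^0V_2$ then $L\vdash\mathsf{B}x[V_1].\,T\to^0\mathsf{B}x[V_2].\,T$; if $L,x[V]\vdash T_1\to^nT_2$ then $L\vdash\mathsf{B}x[V].\,T_1\to^n\mathsf{B}x[V].\,T_2$; if $L\vdash U_1\to^0U_2$ then $L\vdash\mathrm{cast}(U_1,T)\to^0\mathrm{cast}(U_2,T)$; if $L\vdash T_1\to^0T_2$ then $L\vdash\mathrm{cast}(U,T_1)\to^0\mathrm{cast}(U,T_2)$; if $L\vdash U_1\to^1U_2$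 and $L\vdash T_1\to^1T_2$ then $L\vdash\mathrm{cast}(U_1,T_1)\to^1\mathrm{cast}(U_2,T_2)$. The relation $L\vdash T_1\to^{*n}T_2$ ($n\in\mathbb N$) is the smallest relation such that $L\vdash T\to^{*0}T$; $L\vdash T_1\to^nT_2$ implies $L\vdash T_1\to^{*n}T_2$; and $L\vdash T_1\to^{*n_1}T$, $L\vdash T\to^{*n_2}T_2$ imply $L\vdash T_1\to^{*n_1+n_2}T_2$. The relation $\to^{*0}$ is called r-reduction. -}

module Defs where

open import Data.Nat using (ℕ; zero; suc; _<ᵇ_; _+_)
open import Data.Bool using (if_then_else_)

-- Binder kinds: `lam` is de Bruijn's abstraction λx:W, `dfn` is def(x=V).
data BKind : Set where
  lam dfn : BKind

-- Terms over a set of sorts S, variables as de Bruijn indices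
-- (this realises "terms modulo renaming of bound variables").
data Term (S : Set) : Set where
  sort : S → Term S
  var  : ℕ → Term S
  app  : Term S → Term S → Term S            -- app(V,T): T applied to V
  bind : BKind → Term S → Term S → Term S
  cast : Term S → Term S → Term S

-- Environments; the last entry binds index 0.
data Env (S : Set) : Set where
  ∅    : Env S
  _,_∶_ : Env S → BKind → Term S → Env S

infixl 5 _,_∶_

lift : {S : Set} → ℕ → Term S → Term S
lift c (sort s)     = sort s
lift c (var i)      = if i <ᵇ c then var i else var (suc i)
lift c (app V T)    = app (lift c V) (lift c T)
lift c (bind b V T) = bind b (lift c V) (lift (suc c) T)
lift c (cast U T)   = cast (lift c U) (lift c T)

module _ {S : Set} (next : S → S) where

  data _⊢_⇒[_]_ : Env S → Term S → ℕ → Term S → Set where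
    β   : ∀ {L V W T} → L ⊢ app V (bind lam W T) ⇒[ 0 ] bind dfn (cast W V) T
    δ   : ∀ {K V} → (K , dfn ∶ V) ⊢ var 0 ⇒[ 0 ] lift 0 V
    -- x not free in the body: the body is the lift of a term T
    ζ   : ∀ {L V T} → L ⊢ bind dfn V (lift 0 T) ⇒[ 0 ] T
    θ   : ∀ {L V W T} → L ⊢ app V (bind dfn W T) ⇒[ 0 ] bind dfn W (app (lift 0 V) T)
    ε   : ∀ {L U T} → L ⊢ cast U T ⇒[ 0 ] T
    rs  : ∀ {L s} → L ⊢ sort s ⇒[ 1 ] sort (next s)
    rl  : ∀ {K W} → (K , lam ∶ W) ⊢ var 0 ⇒[ 1 ] lift 0 W
    re  : ∀ {L U T} → L ⊢ cast U T ⇒[ 1 ] U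
    wk  : ∀ {K b V i n T} → K ⊢ var i ⇒[ n ] T → (K , b ∶ V) ⊢ var (suc i) ⇒[ n ] lift 0 T
    appₗ : ∀ {L V₁ V₂ T} → L ⊢ V₁ ⇒[ 0 ] V₂ → L ⊢ app V₁ T ⇒[ 0 ] app V₂ T
    appᵣ : ∀ {L V T₁ T₂ n} → L ⊢ T₁ ⇒[ n ] T₂ → L ⊢ app V T₁ ⇒[ n ] app V T₂
    bindₗ : ∀ {L b V₁ V₂ T} → L ⊢ V₁ ⇒[ 0 ] V₂ → L ⊢ bind b V₁ T ⇒[ 0 ] bind b V₂ T
    bindᵣ : ∀ {L b V T₁ T₂ n} → (L , b ∶ V) ⊢ T₁ ⇒[ n ] T₂ → L ⊢ bind b V T₁ ⇒[ n ] bind b V T₂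
    castₗ : ∀ {L U₁ U₂ T} → L ⊢ U₁ ⇒[ 0 ] U₂ → L ⊢ cast U₁ T ⇒[ 0 ] cast U₂ T
    castᵣ : ∀ {L U T₁ T₂} → L ⊢ T₁ ⇒[ 0 ] T₂ → L ⊢ cast U T₁ ⇒[ 0 ] cast U T₂
    cast₁ : ∀ {L U₁ U₂ T₁ T₂} → L ⊢ U₁ ⇒[ 1 ] U₂ → L ⊢ T₁ ⇒[ 1 ] T₂ →
            L ⊢ cast U₁ T₁ ⇒[ 1 ] cast U₂ T₂

  data _⊢_⇒*[_]_ : Env S → Term S → ℕ → Term S → Set where
    refl* : ∀ {L T} → L ⊢ T ⇒*[ 0 ] T
    step* : ∀ {L T₁ T₂ n} → L ⊢ T₁ ⇒[ n ] T₂ → L ⊢ T₁ ⇒*[ n ] T₂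
    trans* : ∀ {L T₁ T T₂ n₁ n₂} → L ⊢ T₁ ⇒*[ n₁ ] T → L ⊢ T ⇒*[ n₂ ] T₂ →
             L ⊢ T₁ ⇒*[ n₁ + n₂ ] T₂

module Submission where

open import Defs
open import Data.Bool using (if_then_else_)
open import Data.Bool.Properties using (if-float)
open import Data.List using (List; []; _∷_)
open import Data.Maybe using (Maybe; just; nothing; map; zipWith)
open import Data.Maybe.Properties using (just-injective)
open import Data.Nat using (ℕ; zero; suc; _+_; _<ᵇ_)
open import Data.Nat.Properties using (m+n≡0⇒m≡0; m+n≡0⇒n≡0)
open import Data.Product using (∃; _×_; _,_)
open import Relation.Binary.Construct.Closure.ReflexiveTransitive using (Star; _◅_; _◅◅_; gmap; _⋆) renaming (ε to done; map to mapStar)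
open import Relation.Binary.Definitions using (DecidableEquality)
open import Relation.Binary.PropositionalEquality using (_≡_; refl; sym; trans; cong; cong₂; module ≡-Reasoning)
open import Relation.Binary.Rewriting using (Confluent)

-- Confluence of r-reduction (Theorem 3.2), by the method of Tait and
-- Martin-Löf with Takahashi's complete developments.
--
-- We define a parallel reduction  L ⊢ T ⇛ U  that contracts an arbitrary
-- set of the β, δ, ζ, θ, ε redexes present in T simultaneously.  One step of
-- r-reduction is a parallel step, and a parallel step is a sequence of
-- r-steps, so the two relations have the same reflexive-transitive closure.
-- For every term we define its complete development  dev E T, which
-- contracts all redexes of T at once, and prove the triangle property
-- L ⊢ T ⇛ T' ⇒ L ⊢ T' ⇛ dev T.  Hence ⇛ has the diamond property, and a
-- general strip-lemma argument makes its closure, i.e. r-reduction, confluent.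
--
-- The technical core is the interaction with de Bruijn shifting: both
-- reductions are stable under weakening of the environment, and conversely
-- a parallel reduct of a shifted term is itself shifted (strengthening).
-- The latter is what lets the development decide ζ-redexes syntactically,
-- via the partial inverse  unshift  of shifting.

Diamond : {A : Set} → (A → A → Set) → Set
Diamond _⇛_ = ∀ {a b c} → a ⇛ b → a ⇛ c → ∃ λ d → b ⇛ d × c ⇛ d

module _ {A : Set} {_⇛_ : A → A → Set} (diamond : Diamond _⇛_) where

  strip : ∀ {a b c} → a ⇛ b → Star _⇛_ a c → ∃ λ d → Star _⇛_ b d × c ⇛ d
  strip ab done = _ , done , ab
  strip ab (ac₁ ◅ c₁c) with diamond ab ac₁
  ... | d₁ , bd₁ , c₁d₁ with strip c₁d₁ c₁c
  ...   | d , d₁d , cd = d , bd₁ ◅ d₁d , cd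

  diamond⇒confluent : Confluent _⇛_
  diamond⇒confluent done ac = _ , ac , done
  diamond⇒confluent (ab₁ ◅ b₁b) ac with strip ab₁ ac
  ... | d₁ , b₁d₁ , cd₁ with diamond⇒confluent b₁b b₁d₁
  ...   | d , bd , d₁d = d , bd , cd₁ ◅ d₁d

zipWith-just : {A B C : Set} (f : A → B → C) (ma : Maybe A) (mb : Maybe B) {c : C} →
  zipWith f ma mb ≡ just c → ∃ λ a → ∃ λ b → ma ≡ just a × mb ≡ just b × c ≡ f a b
zipWith-just f (just a) (just b) refl = a , b , refl , refl , refl

zipWith-map : {A B C A' B' C' : Set} (g : A → B → C) (g' : A' → B' → C')
  {f : A → A'} {f' : B → B'} {h : C → C'} → (∀ a b → g' (f a) (f' b) ≡ h (g a b)) →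
  (ma : Maybe A) (mb : Maybe B) → zipWith g' (map f ma) (map f' mb) ≡ map h (zipWith g ma mb)
zipWith-map g g' distrib (just a) (just b) = cong just (distrib a b)
zipWith-map g g' distrib (just a) nothing  = refl
zipWith-map g g' distrib nothing  mb       = refl

shiftVar : ℕ → ℕ → ℕ
shiftVar zero    i       = suc i
shiftVar (suc c) zero    = zero
shiftVar (suc c) (suc i) = suc (shiftVar c i)

unshiftVar : ℕ → ℕ → Maybe ℕ
unshiftVar zero    zero    = nothing
unshiftVar zero    (suc i) = just i
unshiftVar (suc c) zero    = just zero
unshiftVar (suc c) (suc i) = map suc (unshiftVar c i)

shiftVar-spec : ∀ c i → (if i <ᵇ c then i else suc i) ≡ shiftVar c i
shiftVar-spec zero    i       = refl
shiftVar-spec (suc c) zero    = refl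
shiftVar-spec (suc c) (suc i) = trans (sym (if-float suc (i <ᵇ c))) (cong suc (shiftVar-spec c i))

shiftVar-comm : ∀ k d i → shiftVar (suc (k + d)) (shiftVar k i) ≡ shiftVar k (shiftVar (k + d) i)
shiftVar-comm zero    d i       = refl
shiftVar-comm (suc k) d zero    = refl
shiftVar-comm (suc k) d (suc i) = cong suc (shiftVar-comm k d i)

unshiftVar-shiftVar : ∀ c i → unshiftVar c (shiftVar c i) ≡ just i
unshiftVar-shiftVar zero    i       = refl
unshiftVar-shiftVar (suc c) zero    = refl
unshiftVar-shiftVar (suc c) (suc i) = cong (map suc) (unshiftVar-shiftVar c i)

unshiftVar-sound : ∀ c i {j} → unshiftVar c i ≡ just j → i ≡ shiftVar c j
unshiftVar-sound zero    (suc i) refl = refl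
unshiftVar-sound (suc c) zero    refl = refl
unshiftVar-sound (suc c) (suc i) eq with unshiftVar c i in e
unshiftVar-sound (suc c) (suc i) refl | just _ = cong suc (unshiftVar-sound c i e)

unshiftVar-comm : ∀ k d i → unshiftVar k (shiftVar (suc (k + d)) i) ≡ map (shiftVar (k + d)) (unshiftVar k i)
unshiftVar-comm zero    d zero    = refl
unshiftVar-comm zero    d (suc i) = refl
unshiftVar-comm (suc k) d zero    = refl
unshiftVar-comm (suc k) d (suc i) rewrite unshiftVar-comm k d i with unshiftVar k i
... | just _  = refl
... | nothing = refl

module _ {S : Set} where

  -- shift c T : weakening of T by a fresh variable at depth c.  This is the
  -- structural form of `lift` from Defs (see lift≡shift).
  shift : ℕ → Term S → Term S
  shift c (sort s)     = sort s
  shift c (var i)      = var (shiftVar c i)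
  shift c (app V T)    = app (shift c V) (shift c T)
  shift c (bind b V T) = bind b (shift c V) (shift (suc c) T)
  shift c (cast U T)   = cast (shift c U) (shift c T)

  lift≡shift : ∀ c T → lift c T ≡ shift c T
  lift≡shift c (sort s)     = refl
  lift≡shift c (var i)      = trans (sym (if-float var (i <ᵇ c))) (cong var (shiftVar-spec c i))
  lift≡shift c (app V T)    = cong₂ app (lift≡shift c V) (lift≡shift c T)
  lift≡shift c (bind b V T) = cong₂ (bind b) (lift≡shift c V) (lift≡shift (suc c) T)
  lift≡shift c (cast U T)   = cong₂ cast (lift≡shift c U) (lift≡shift c T)

  shift-comm : ∀ k d T → shift (suc (k + d)) (shift k T) ≡ shift k (shift (k + d) T)
  shift-comm k d (sort s)     = refl
  shift-comm k d (var i)      = cong var (shiftVar-comm k d i)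
  shift-comm k d (app V T)    = cong₂ app (shift-comm k d V) (shift-comm k d T)
  shift-comm k d (bind b V T) = cong₂ (bind b) (shift-comm k d V) (shift-comm (suc k) d T)
  shift-comm k d (cast U T)   = cong₂ cast (shift-comm k d U) (shift-comm k d T)

  shift0-comm : ∀ c T → shift 0 (shift c T) ≡ shift (suc c) (shift 0 T)
  shift0-comm c T = sym (shift-comm 0 c T)

  lift0-shift : ∀ c T → lift 0 (shift c T) ≡ shift (suc c) (lift 0 T)
  lift0-shift c T = begin
    lift 0 (shift c T)         ≡⟨ lift≡shift 0 (shift c T) ⟩
    shift 0 (shift c T)        ≡⟨ shift0-comm c T ⟩
    shift (suc c) (shift 0 T)  ≡⟨ cong (shift (suc c)) (sym (lift≡shift 0 T)) ⟩
    shift (suc c) (lift 0 T)   ∎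
    where open ≡-Reasoning

  -- unshift c T = just X exactly when T = shift c X, i.e. when variable c
  -- does not occur in T; this decides the side condition of ζ.
  unshift : ℕ → Term S → Maybe (Term S)
  unshift c (sort s)     = just (sort s)
  unshift c (var i)      = map var (unshiftVar c i)
  unshift c (app V T)    = zipWith app (unshift c V) (unshift c T)
  unshift c (bind b V T) = zipWith (bind b) (unshift c V) (unshift (suc c) T)
  unshift c (cast U T)   = zipWith cast (unshift c U) (unshift c T)

  unshift-shift : ∀ c T → unshift c (shift c T) ≡ just T
  unshift-shift c (sort s)     = refl
  unshift-shift c (var i)      = cong (map var) (unshiftVar-shiftVar c i)
  unshift-shift c (app V T)    = cong₂ (zipWith app) (unshift-shift c V) (unshift-shift c T)
  unshift-shift c (bind b V T) = cong₂ (zipWith (bind b)) (unshift-shift c V) (unshift-shift (suc c) T)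
  unshift-shift c (cast U T)   = cong₂ (zipWith cast) (unshift-shift c U) (unshift-shift c T)

  unshift-sound : ∀ c T {X} → unshift c T ≡ just X → T ≡ shift c X
  unshift-sound c (sort s) refl = refl
  unshift-sound c (var i) eq with unshiftVar c i in e
  unshift-sound c (var i) refl | just _ = cong var (unshiftVar-sound c i e)
  unshift-sound c (app V T) eq with zipWith-just app _ _ eq
  ... | _ , _ , eV , eT , refl = cong₂ app (unshift-sound c V eV) (unshift-sound c T eT)
  unshift-sound c (bind b V T) eq with zipWith-just (bind b) _ _ eq
  ... | _ , _ , eV , eT , refl = cong₂ (bind b) (unshift-sound c V eV) (unshift-sound (suc c) T eT)
  unshift-sound c (cast U T) eq with zipWith-just cast _ _ eq
  ... | _ , _ , eU , eT , refl = cong₂ cast (unshift-sound c U eU) (unshift-sound c T eT)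

  unshift-comm : ∀ k d T → unshift k (shift (suc (k + d)) T) ≡ map (shift (k + d)) (unshift k T)
  unshift-comm k d (sort s) = refl
  unshift-comm k d (var i) rewrite unshiftVar-comm k d i with unshiftVar k i
  ... | just _  = refl
  ... | nothing = refl
  unshift-comm k d (app V T) =
    trans (cong₂ (zipWith app) (unshift-comm k d V) (unshift-comm k d T))
          (zipWith-map app app (λ _ _ → refl) (unshift k V) (unshift k T))
  unshift-comm k d (bind b V T) =
    trans (cong₂ (zipWith (bind b)) (unshift-comm k d V) (unshift-comm (suc k) d T))
          (zipWith-map (bind b) (bind b) (λ _ _ → refl) (unshift k V) (unshift (suc k) T))
  unshift-comm k d (cast U T) =
    trans (cong₂ (zipWith cast) (unshift-comm k d U) (unshift-comm k d T))
          (zipWith-map cast cast (λ _ _ → refl) (unshift k U) (unshift k T))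

  -- A term that is a shift both at depth k and at depth k+d+1 comes from a
  -- single term shifted at both depths.  Needed to strengthen ζ-steps.
  shift-meet : ∀ k d U U₁ → shift k U ≡ shift (suc (k + d)) U₁ →
    ∃ λ U' → U ≡ shift (k + d) U' × U₁ ≡ shift k U'
  shift-meet k d U U₁ e with unshift k U₁ in eq | unshifted
    where
    unshifted : just U ≡ map (shift (k + d)) (unshift k U₁)
    unshifted = trans (sym (unshift-shift k U)) (trans (cong (unshift k) e) (unshift-comm k d U₁))
  ... | just U' | u = U' , just-injective u , unshift-sound k U₁ eq

  insertAt : ℕ → Env S → BKind → Term S → Env S
  insertAt zero    L            b X = L , b ∶ X
  insertAt (suc c) ∅            b X = ∅
  insertAt (suc c) (L , b' ∶ V) b X = insertAt c L b X , b' ∶ shift c V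

-- A development context records, for each variable of an environment, the
-- development of its definition, or nothing for a declared variable.
DevCtx : Set → Set
DevCtx S = List (Maybe (Term S))

module _ {S : Set} where

  devVar : DevCtx S → ℕ → Term S
  devVar []            i       = var i
  devVar (nothing ∷ E) zero    = var zero
  devVar (just X ∷ E)  zero    = shift 0 X
  devVar (_ ∷ E)       (suc i) = shift 0 (devVar E i)

  devDef : Term S → Term S → Term S
  devDef W B with unshift 0 B
  ... | just X  = X
  ... | nothing = bind dfn W B

  devθ : Term S → Term S → Term S → Term S
  devθ V W B with unshift 0 B
  ... | just X  = app V X
  ... | nothing = bind dfn W (app (shift 0 V) B)

  devDef-shift : ∀ W X → devDef W (shift 0 X) ≡ X
  devDef-shift W X rewrite unshift-shift 0 X = refl

  devθ-shift : ∀ V W X → devθ V W (shift 0 X) ≡ app V X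
  devθ-shift V W X rewrite unshift-shift 0 X = refl

  dev : DevCtx S → Term S → Term S
  dev E (sort s)                 = sort s
  dev E (var i)                  = devVar E i
  dev E (app V (bind lam W T))   = bind dfn (cast (dev E W) (dev E V)) (dev (nothing ∷ E) T)
  dev E (app V (bind dfn W T))   = devθ (dev E V) (dev E W) (dev (just (dev E W) ∷ E) T)
  dev E (app V T)                = app (dev E V) (dev E T)
  dev E (bind lam W T)           = bind lam (dev E W) (dev (nothing ∷ E) T)
  dev E (bind dfn W T)           = devDef (dev E W) (dev (just (dev E W) ∷ E) T)
  dev E (cast U T)               = dev E T

  devCtx : Env S → DevCtx S
  devCtx ∅              = []
  devCtx (K , lam ∶ V) = nothing ∷ devCtx K
  devCtx (K , dfn ∶ V) = just (dev (devCtx K) V) ∷ devCtx K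

module _ {S : Set} (next : S → S) where

  private variable
    L L' K   : Env S
    E        : DevCtx S
    b        : BKind
    s        : S
    i        : ℕ
    B B' T T' U U' V V' W W' X : Term S

  infix 4 _⊢_⟶[_]_ _⊢_⟶_ _⊢_⟶*_ _⊢_⇛_ _⇛ᴱ_

  _⊢_⟶[_]_ : Env S → Term S → ℕ → Term S → Set
  _⊢_⟶[_]_ = _⊢_⇒[_]_ next

  _⊢_⟶_ : Env S → Term S → Term S → Set
  L ⊢ T ⟶ U = L ⊢ T ⟶[ 0 ] U

  _⊢_⟶*_ : Env S → Term S → Term S → Set
  L ⊢ T ⟶* U = Star (L ⊢_⟶_) T U

  weaken-step : ∀ c {n} → L ⊢ T ⟶[ n ] U → insertAt c L b X ⊢ shift c T ⟶[ n ] shift c U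
  weaken-step c       β                = β
  weaken-step zero    (δ {V = V})      rewrite sym (lift≡shift 0 (lift 0 V)) = wk δ
  weaken-step (suc c) (δ {V = V})      rewrite sym (lift0-shift c V) = δ
  weaken-step c       (ζ {T = T})      rewrite sym (lift0-shift c T) = ζ
  weaken-step c       (θ {V = V})      rewrite sym (lift0-shift c V) = θ
  weaken-step c       ε                = ε
  weaken-step c       rs               = rs
  weaken-step zero    (rl {W = W})     rewrite sym (lift≡shift 0 (lift 0 W)) = wk rl
  weaken-step (suc c) (rl {W = W})     rewrite sym (lift0-shift c W) = rl
  weaken-step c       re               = re
  weaken-step zero    (wk {T = T} d)   rewrite sym (lift≡shift 0 (lift 0 T)) = wk (wk d)
  weaken-step (suc c) (wk {T = T} d)   rewrite sym (lift0-shift c T) = wk (weaken-step c d)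
  weaken-step c       (appₗ d)         = appₗ (weaken-step c d)
  weaken-step c       (appᵣ d)         = appᵣ (weaken-step c d)
  weaken-step c       (bindₗ d)        = bindₗ (weaken-step c d)
  weaken-step c       (bindᵣ d)        = bindᵣ (weaken-step (suc c) d)
  weaken-step c       (castₗ d)        = castₗ (weaken-step c d)
  weaken-step c       (castᵣ d)        = castᵣ (weaken-step c d)
  weaken-step c       (cast₁ d e)      = cast₁ (weaken-step c d) (weaken-step c e)

  data _⊢_⇛_ : Env S → Term S → Term S → Set where
    ⇛sort : L ⊢ sort s ⇛ sort s
    ⇛var  : L ⊢ var i ⇛ var i
    ⇛δ    : K ⊢ V ⇛ V' → K , dfn ∶ V ⊢ var 0 ⇛ shift 0 V'
    ⇛wk   : K ⊢ var i ⇛ T → K , b ∶ V ⊢ var (suc i) ⇛ shift 0 T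
    ⇛app  : L ⊢ V ⇛ V' → L ⊢ T ⇛ T' → L ⊢ app V T ⇛ app V' T'
    ⇛bind : L ⊢ V ⇛ V' → L , b ∶ V ⊢ T ⇛ T' → L ⊢ bind b V T ⇛ bind b V' T'
    ⇛cast : L ⊢ U ⇛ U' → L ⊢ T ⇛ T' → L ⊢ cast U T ⇛ cast U' T'
    ⇛β    : L ⊢ V ⇛ V' → L ⊢ W ⇛ W' → L , lam ∶ W ⊢ T ⇛ T' →
            L ⊢ app V (bind lam W T) ⇛ bind dfn (cast W' V') T'
    ⇛θ    : L ⊢ V ⇛ V' → L ⊢ W ⇛ W' → L , dfn ∶ W ⊢ T ⇛ T' →
            L ⊢ app V (bind dfn W T) ⇛ bind dfn W' (app (shift 0 V') T')
    ⇛ζ    : L , dfn ∶ V ⊢ T ⇛ shift 0 T' → L ⊢ bind dfn V T ⇛ T'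
    ⇛ε    : L ⊢ T ⇛ T' → L ⊢ cast U T ⇛ T'

  ⇛refl : ∀ T → L ⊢ T ⇛ T
  ⇛refl (sort s)     = ⇛sort
  ⇛refl (var i)      = ⇛var
  ⇛refl (app V T)    = ⇛app (⇛refl V) (⇛refl T)
  ⇛refl (bind b V T) = ⇛bind (⇛refl V) (⇛refl T)
  ⇛refl (cast U T)   = ⇛cast (⇛refl U) (⇛refl T)

  -- Every r-step is a parallel step (degree-1 steps are excluded by the index).
  step⇒par : L ⊢ T ⟶ U → L ⊢ T ⇛ U
  step⇒par β                                     = ⇛β (⇛refl _) (⇛refl _) (⇛refl _)
  step⇒par (δ {V = V})   rewrite lift≡shift 0 V = ⇛δ (⇛refl V)
  step⇒par (ζ {T = T})   rewrite lift≡shift 0 T = ⇛ζ (⇛refl _)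
  step⇒par (θ {V = V})   rewrite lift≡shift 0 V = ⇛θ (⇛refl _) (⇛refl _) (⇛refl _)
  step⇒par ε                                     = ⇛ε (⇛refl _)
  step⇒par (wk {T = T} d) rewrite lift≡shift 0 T = ⇛wk (step⇒par d)
  step⇒par (appₗ d)      = ⇛app (step⇒par d) (⇛refl _)
  step⇒par (appᵣ d)      = ⇛app (⇛refl _) (step⇒par d)
  step⇒par (bindₗ d)     = ⇛bind (step⇒par d) (⇛refl _)
  step⇒par (bindᵣ d)     = ⇛bind (⇛refl _) (step⇒par d)
  step⇒par (castₗ d)     = ⇛cast (step⇒par d) (⇛refl _)
  step⇒par (castᵣ d)     = ⇛cast (⇛refl _) (step⇒par d)

  δ↑ : K , dfn ∶ V ⊢ var 0 ⟶ shift 0 V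
  δ↑ {V = V} rewrite sym (lift≡shift 0 V) = δ

  ζ↑ : L ⊢ bind dfn V (shift 0 T) ⟶ T
  ζ↑ {T = T} rewrite sym (lift≡shift 0 T) = ζ

  θ↑ : L ⊢ app V (bind dfn W T) ⟶ bind dfn W (app (shift 0 V) T)
  θ↑ {V = V} rewrite sym (lift≡shift 0 V) = θ

  -- Every parallel step is a sequence of r-steps: contract the redexes one
  -- by one, innermost reductions first.
  par⇒steps : L ⊢ T ⇛ U → L ⊢ T ⟶* U
  par⇒steps ⇛sort       = done
  par⇒steps ⇛var        = done
  par⇒steps (⇛δ d)      = δ↑ ◅ gmap (shift 0) (weaken-step 0) (par⇒steps d)
  par⇒steps (⇛wk d)     = gmap (shift 0) (weaken-step 0) (par⇒steps d)
  par⇒steps (⇛app dV dT) =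
    gmap (λ z → app z _) appₗ (par⇒steps dV) ◅◅ gmap (app _) appᵣ (par⇒steps dT)
  par⇒steps (⇛bind dV dT) =
    gmap (bind _ _) bindᵣ (par⇒steps dT) ◅◅ gmap (λ z → bind _ z _) bindₗ (par⇒steps dV)
  par⇒steps (⇛cast dU dT) =
    gmap (λ z → cast z _) castₗ (par⇒steps dU) ◅◅ gmap (cast _) castᵣ (par⇒steps dT)
  par⇒steps (⇛β dV dW dT) =
    gmap (λ z → app _ (bind lam _ z)) (λ s → appᵣ (bindᵣ s)) (par⇒steps dT) ◅◅
    gmap (λ z → app _ (bind lam z _)) (λ s → appᵣ (bindₗ s)) (par⇒steps dW) ◅◅
    gmap (λ z → app z (bind lam _ _)) appₗ (par⇒steps dV) ◅◅ β ◅ done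
  par⇒steps (⇛θ dV dW dT) =
    gmap (λ z → app _ (bind dfn _ z)) (λ s → appᵣ (bindᵣ s)) (par⇒steps dT) ◅◅
    gmap (λ z → app _ (bind dfn z _)) (λ s → appᵣ (bindₗ s)) (par⇒steps dW) ◅◅
    gmap (λ z → app z (bind dfn _ _)) appₗ (par⇒steps dV) ◅◅ θ↑ ◅ done
  par⇒steps (⇛ζ d)      = gmap (bind _ _) bindᵣ (par⇒steps d) ◅◅ ζ↑ ◅ done
  par⇒steps (⇛ε d)      = gmap (cast _) castᵣ (par⇒steps d) ◅◅ ε ◅ done

  ⇛-target : U ≡ U' → L ⊢ T ⇛ U → L ⊢ T ⇛ U'
  ⇛-target refl d = d

  weaken-par : ∀ c → L ⊢ T ⇛ U → insertAt c L b X ⊢ shift c T ⇛ shift c U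
  weaken-par c       ⇛sort                  = ⇛sort
  weaken-par c       ⇛var                   = ⇛var
  weaken-par zero    (⇛δ d)                 = ⇛wk (⇛δ d)
  weaken-par (suc c) (⇛δ {V' = V'} d)       rewrite sym (shift0-comm c V') = ⇛δ (weaken-par c d)
  weaken-par zero    (⇛wk d)                = ⇛wk (⇛wk d)
  weaken-par (suc c) (⇛wk {T = T} d)        rewrite sym (shift0-comm c T) = ⇛wk (weaken-par c d)
  weaken-par c       (⇛app dV dT)           = ⇛app (weaken-par c dV) (weaken-par c dT)
  weaken-par c       (⇛bind dV dT)          = ⇛bind (weaken-par c dV) (weaken-par (suc c) dT)
  weaken-par c       (⇛cast dU dT)          = ⇛cast (weaken-par c dU) (weaken-par c dT)
  weaken-par c       (⇛β dV dW dT)          = ⇛β (weaken-par c dV) (weaken-par c dW) (weaken-par (suc c) dT)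
  weaken-par c       (⇛θ {V' = V'} dV dW dT) rewrite sym (shift0-comm c V') =
    ⇛θ (weaken-par c dV) (weaken-par c dW) (weaken-par (suc c) dT)
  weaken-par c       (⇛ζ {T' = T'} dT)      = ⇛ζ (⇛-target (sym (shift0-comm c T')) (weaken-par (suc c) dT))
  weaken-par c       (⇛ε dT)                = ⇛ε (weaken-par c dT)

  -- The equations let us match on the
  -- derivation while the environment and term are given in shifted form.
  strengthen : ∀ {L₀ T₀ U} → L₀ ⊢ T₀ ⇛ U → ∀ c L {b X} T → L₀ ≡ insertAt c L b X → T₀ ≡ shift c T →
    ∃ λ U' → U ≡ shift c U' × L ⊢ T ⇛ U'
  strengthen ⇛sort c L (sort s) refl refl = sort s , refl , ⇛sort
  strengthen ⇛var  c L (var j)  refl refl = var j , refl , ⇛var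
  strengthen (⇛δ d) (suc c) (K , _ ∶ V) (var zero) refl refl with strengthen d c K V refl refl
  ... | V₁ , e , d₁ = shift 0 V₁ , trans (cong (shift 0) e) (shift0-comm c V₁) , ⇛δ d₁
  strengthen (⇛δ d) zero    L (var j)       _  ()
  strengthen (⇛δ d) (suc c) L (var (suc j)) _  ()
  strengthen (⇛δ d) (suc c) ∅ (var zero)    () _
  strengthen (⇛wk d) zero L (var j) refl refl = _ , refl , d
  strengthen (⇛wk d) (suc c) (K , _ ∶ V) (var (suc j)) refl refl with strengthen d c K (var j) refl refl
  ... | T₁ , e , d₁ = shift 0 T₁ , trans (cong (shift 0) e) (shift0-comm c T₁) , ⇛wk d₁
  strengthen (⇛wk d) (suc c) L (var zero)    _  ()
  strengthen (⇛wk d) (suc c) ∅ (var (suc j)) () _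
  strengthen (⇛app dA dB) c L (app A B) refl refl
    with strengthen dA c L A refl refl | strengthen dB c L B refl refl
  ... | A₁ , eA , dA₁ | B₁ , eB , dB₁ = app A₁ B₁ , cong₂ app eA eB , ⇛app dA₁ dB₁
  strengthen (⇛bind {b = b} dA dB) c L (bind _ A B) refl refl
    with strengthen dA c L A refl refl | strengthen dB (suc c) (L , b ∶ A) B refl refl
  ... | A₁ , eA , dA₁ | B₁ , eB , dB₁ = bind b A₁ B₁ , cong₂ (bind b) eA eB , ⇛bind dA₁ dB₁
  strengthen (⇛cast dA dB) c L (cast A B) refl refl
    with strengthen dA c L A refl refl | strengthen dB c L B refl refl
  ... | A₁ , eA , dA₁ | B₁ , eB , dB₁ = cast A₁ B₁ , cong₂ cast eA eB , ⇛cast dA₁ dB₁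
  strengthen (⇛β dA dW dB) c L (app A (bind _ W B)) refl refl
    with strengthen dA c L A refl refl | strengthen dW c L W refl refl
       | strengthen dB (suc c) (L , lam ∶ W) B refl refl
  ... | A₁ , eA , dA₁ | W₁ , eW , dW₁ | B₁ , eB , dB₁ =
    bind dfn (cast W₁ A₁) B₁ , cong₂ (bind dfn) (cong₂ cast eW eA) eB , ⇛β dA₁ dW₁ dB₁
  strengthen (⇛θ dA dW dB) c L (app A (bind _ W B)) refl refl
    with strengthen dA c L A refl refl | strengthen dW c L W refl refl
       | strengthen dB (suc c) (L , dfn ∶ W) B refl refl
  ... | A₁ , eA , dA₁ | W₁ , eW , dW₁ | B₁ , eB , dB₁ =
    bind dfn W₁ (app (shift 0 A₁) B₁) ,
    cong₂ (bind dfn) eW (cong₂ app (trans (cong (shift 0) eA) (shift0-comm c A₁)) eB) ,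
    ⇛θ dA₁ dW₁ dB₁
  strengthen (⇛ζ {T' = T'} dB) c L (bind _ A B) refl refl with strengthen dB (suc c) (L , dfn ∶ A) B refl refl
  ... | B₁ , eB , dB₁ with shift-meet 0 c T' B₁ eB
  ...   | T₁ , eT , eB₁ = T₁ , eT , ⇛ζ (⇛-target eB₁ dB₁)
  strengthen (⇛ε dB) c L (cast A B) refl refl with strengthen dB c L B refl refl
  ... | B₁ , eB , dB₁ = B₁ , eB , ⇛ε dB₁

  -- Variables that E does not unfold may be of either kind in L:
  -- a β-contraction turns a declaration x:W into a definition x=cast(W,V).
  data _⇛ᴱ_ : Env S → DevCtx S → Set where
    []ᴱ   : ∅ ⇛ᴱ []
    keepᴱ : L ⇛ᴱ E → L , b ∶ V ⇛ᴱ nothing ∷ E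
    dfnᴱ : L ⇛ᴱ E → L ⊢ V ⇛ X → L , dfn ∶ V ⇛ᴱ just X ∷ E

  ⇛devDef : L ⊢ W' ⇛ W → L , dfn ∶ W' ⊢ B' ⇛ B → L ⊢ bind dfn W' B' ⇛ devDef W B
  ⇛devDef {B = B} dW dB with unshift 0 B in eq
  ... | just X  = ⇛ζ (⇛-target (unshift-sound 0 B eq) dB)
  ... | nothing = ⇛bind dW dB

  ⇛devθ : L ⊢ V' ⇛ V → L ⊢ W' ⇛ W → L , dfn ∶ W' ⊢ B' ⇛ B →
    L ⊢ app V' (bind dfn W' B') ⇛ devθ V W B
  ⇛devθ {B = B} dV dW dB with unshift 0 B in eq
  ... | just X  = ⇛app dV (⇛ζ (⇛-target (unshift-sound 0 B eq) dB))
  ... | nothing = ⇛θ dV dW dB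

  ⇛devθ-θ : L ⊢ V' ⇛ V → L ⊢ W' ⇛ W → L , dfn ∶ W' ⊢ B' ⇛ B →
    L ⊢ bind dfn W' (app (shift 0 V') B') ⇛ devθ V W B
  ⇛devθ-θ {B = B} dV dW dB with unshift 0 B in eq
  ... | just X  = ⇛ζ (⇛app (weaken-par 0 dV) (⇛-target (unshift-sound 0 B eq) dB))
  ... | nothing = ⇛bind dW (⇛app (weaken-par 0 dV) dB)

  triangle-var : ∀ L i → L' ⇛ᴱ devCtx L → L' ⊢ var i ⇛ devVar (devCtx L) i
  triangle-var ∅             i       []ᴱ        = ⇛var
  triangle-var (K , lam ∶ V) zero    (keepᴱ r)  = ⇛var
  triangle-var (K , dfn ∶ V) zero    (dfnᴱ r d) = ⇛δ d
  triangle-var (K , lam ∶ V) (suc i) (keepᴱ r)  = ⇛wk (triangle-var K i r)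
  triangle-var (K , dfn ∶ V) (suc i) (dfnᴱ r d) = ⇛wk (triangle-var K i r)

  -- The environment L' may itself be a
  -- parallel reduct of L, as happens under binders whose type was reduced.
  triangle : L ⊢ T ⇛ T' → L' ⇛ᴱ devCtx L → L' ⊢ T' ⇛ dev (devCtx L) T
  triangle ⇛sort r = ⇛sort
  triangle {L = L} (⇛var {i = i}) r = triangle-var L i r
  triangle (⇛δ d) (dfnᴱ r _) = weaken-par 0 (triangle d r)
  triangle (⇛wk {b = lam} d) (keepᴱ r) = weaken-par 0 (triangle d r)
  triangle (⇛wk {b = dfn} d) (dfnᴱ r _) = weaken-par 0 (triangle d r)
  triangle (⇛app {T = bind lam W B} dV (⇛bind dW dB)) r =
    ⇛β (triangle dV r) (triangle dW r) (triangle dB (keepᴱ r))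
  triangle (⇛app {T = bind dfn W B} dV (⇛bind dW dB)) r =
    ⇛devθ (triangle dV r) (triangle dW r) (triangle dB (dfnᴱ r (triangle dW r)))
  triangle {L = L} {L' = L'} (⇛app {V = V} {T = bind dfn W B} {T' = T'} dV (⇛ζ dB)) r
    with strengthen (triangle dB (dfnᴱ r (⇛refl (dev (devCtx L) W)))) 0 L' T' refl refl
  ... | X , e , dX =
    ⇛-target (sym (trans (cong (devθ _ _) e) (devθ-shift _ _ X))) (⇛app (triangle dV r) dX)
  triangle (⇛app {T = sort _}   dV dT) r = ⇛app (triangle dV r) (triangle dT r)
  triangle (⇛app {T = var _}    dV dT) r = ⇛app (triangle dV r) (triangle dT r)
  triangle (⇛app {T = app _ _}  dV dT) r = ⇛app (triangle dV r) (triangle dT r)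
  triangle (⇛app {T = cast _ _} dV dT) r = ⇛app (triangle dV r) (triangle dT r)
  triangle (⇛bind {b = lam} dV dT) r = ⇛bind (triangle dV r) (triangle dT (keepᴱ r))
  triangle (⇛bind {b = dfn} dV dT) r = ⇛devDef (triangle dV r) (triangle dT (dfnᴱ r (triangle dV r)))
  triangle (⇛cast dU dT) r = ⇛ε (triangle dT r)
  triangle (⇛β dV dW dT) r = ⇛bind (⇛cast (triangle dW r) (triangle dV r)) (triangle dT (keepᴱ r))
  triangle (⇛θ dV dW dT) r = ⇛devθ-θ (triangle dV r) (triangle dW r) (triangle dT (dfnᴱ r (triangle dW r)))
  triangle {L = L} {L' = L'} (⇛ζ {V = V} {T' = T'} dT) r
    with strengthen (triangle dT (dfnᴱ r (⇛refl (dev (devCtx L) V)))) 0 L' T' refl refl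
  ... | X , e , dX = ⇛-target (sym (trans (cong (devDef _) e) (devDef-shift _ X))) dX
  triangle (⇛ε dT) r = triangle dT r

  devCtx-⇛ᴱ : ∀ L → L ⇛ᴱ devCtx L
  devCtx-⇛ᴱ ∅             = []ᴱ
  devCtx-⇛ᴱ (K , lam ∶ V) = keepᴱ (devCtx-⇛ᴱ K)
  devCtx-⇛ᴱ (K , dfn ∶ V) = dfnᴱ (devCtx-⇛ᴱ K) (triangle (⇛refl V) (devCtx-⇛ᴱ K))

  ⇛-diamond : Diamond (L ⊢_⇛_)
  ⇛-diamond {L} {T} d e = dev (devCtx L) T , triangle d (devCtx-⇛ᴱ L) , triangle e (devCtx-⇛ᴱ L)

  -- Confluence of r-reduction: its closure coincides with that of ⇛.
  r-confluent : Confluent (L ⊢_⟶_)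
  r-confluent r₁ r₂ with diamond⇒confluent ⇛-diamond (mapStar step⇒par r₁) (mapStar step⇒par r₂)
  ... | T , p₁ , p₂ = T , (par⇒steps ⋆) p₁ , (par⇒steps ⋆) p₂

  iterated⇒star : ∀ {n} → _⊢_⇒*[_]_ next L T n U → n ≡ 0 → L ⊢ T ⟶* U
  iterated⇒star refl*                  _    = done
  iterated⇒star (step* s)              refl = s ◅ done
  iterated⇒star (trans* {n₁ = n₁} r q) e    =
    iterated⇒star r (m+n≡0⇒m≡0 n₁ e) ◅◅ iterated⇒star q (m+n≡0⇒n≡0 n₁ e)

  star⇒iterated : L ⊢ T ⟶* U → _⊢_⇒*[_]_ next L T 0 U
  star⇒iterated done    = refl*
  star⇒iterated (s ◅ r) = trans* (step* s) (star⇒iterated r)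

-- Theorem 3.2.
theorem3p2 : {S : Set} → DecidableEquality S → S → (next : S → S) →
    (L : Env S) (T₀ T₁ T₂ : Term S) →
    _⊢_⇒*[_]_ next L T₀ 0 T₁ → _⊢_⇒*[_]_ next L T₀ 0 T₂ →
    ∃ λ T → _⊢_⇒*[_]_ next L T₁ 0 T × _⊢_⇒*[_]_ next L T₂ 0 T
theorem3p2 _ _ next L T₀ T₁ T₂ r₁ r₂
  with r-confluent next (iterated⇒star next r₁ refl) (iterated⇒star next r₂ refl)
... | T , q₁ , q₂ = T , star⇒iterated next q₁ , star⇒iterated next q₂
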